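{- Let $n\ge1$ and let $x,y$ be coprime integers with $1\le x<y$; set $d_k=x^{n-k}y^k$ for $k\in\{0,\dots,n+1\}$ (so $d_{n+1}=y^{n+1}/x$). Every integer $v\ge0$ has a unique decomposition of the form \[ v=\sum_{k=0}^{n}c_kd_k+c_{n+1}d_{n+1}\] with $c_k\in\{0,\dots,y-1\}$ for $k\in\{0,\dots,n\}$ and $c_{n+1}\in x\mathbb{Z}$. -}

module Defs where

open import Data.Nat using (ℕ; zero; suc; _*_; _∸_; _^_; _<_)
open import Data.Fin using (Fin; toℕ)
open import Data.Vec using (Vec; sum; zipWith; tabulate)
open import Data.Vec.Relation.Unary.All using (All)
open import Data.Integer as ℤ using (ℤ; +_)
open import Data.Integer.Divisibility as ℤd using ()
open import Data.Rational as ℚ using (ℚ; _/_; 0ℚ)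
open import Data.Product using (_×_)
open import Relation.Binary.PropositionalEquality using (_≡_)

d : (x y n : ℕ) → Fin (suc n) → ℕ
d x y n k = x ^ (n ∸ toℕ k) * y ^ toℕ k

-- d_{n+1} = y^(n+1)/x as a rational (junk value 0 when x = 0, excluded by x ≥ 1)
dTop : ℕ → ℕ → ℕ → ℚ
dTop zero    y n = 0ℚ
dTop (suc x) y n = (+ (y ^ suc n)) / suc x

lowSum : (x y n : ℕ) → Vec ℕ (suc n) → ℕ
lowSum x y n c = sum (zipWith _*_ c (tabulate (d x y n)))

IsDecomp : (x y n v : ℕ) → Vec ℕ (suc n) → ℤ → Set
IsDecomp x y n v c e =
  All (_< y) c × (+ x) ℤd.∣ e ×
  ((+ v) / 1 ≡ ((+ lowSum x y n c) / 1) ℚ.+ ((e / 1) ℚ.* dTop x y n))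

-- Clearing the denominator x, a decomposition with c_{n+1} = f x says
-- v = c_0 x^n + y (c_1 x^(n-1) + y (⋯ + y (c_n + y f))).  Modulo y this forces
-- c_0 ≡ v x^(-n), which pins down c_0 ∈ [0, y) because x is invertible modulo y;
-- the bracket is then an expansion of the same shape of lower degree, so
-- induction gives existence and uniqueness at once.
module Submission where

open import Data.Fin using (Fin; toℕ) renaming (zero to fzero; suc to fsuc)
open import Data.Integer as ℤ using (ℤ; +_; _+_; _-_; _*_; -_; ∣_∣; 1ℤ)
open import Data.Integer.Coprimality as ℤC using ()
open import Data.Integer.Divisibility.Signed as ℤS using (∣ᵤ⇒∣; ∣⇒∣ᵤ)
open import Data.Integer.DivMod using (_%ℕ_; _/ℕ_; a≡a%ℕn+[a/ℕn]*n; n%ℕd<d)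
import Data.Integer.Properties as ℤP
open import Algebra.Properties.AbelianGroup ℤP.+-0-abelianGroup using () renaming (∙-cancelˡ to +-cancelˡ)
open import Data.Integer.Tactic.RingSolver using (solve)
import Data.List as List
open import Data.Nat as ℕ using (ℕ; zero; suc; _≤_; _<_; _^_; s≤s; z≤n; NonZero)
open import Data.Nat.Coprimality as Coprimality using (Coprime; coprime-Bézout; coprime-divisor)
open import Data.Nat.Divisibility using (_∣_; ∣-trans; ∣⇒≤)
open import Data.Nat.GCD using (module Bézout)
import Data.Nat.Properties as ℕP
open import Algebra.Properties.CommutativeSemigroup ℕP.*-commutativeSemigroup using (x∙yz≈y∙xz)
open import Data.Product using (_×_; _,_; ∃-syntax; ∃₂)
open import Data.Rational as ℚ using (_/_; toℚᵘ)
import Data.Rational.Properties as ℚP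
open import Data.Rational.Unnormalised as ℚᵘ using (*≡*; _≃_) renaming (_/_ to _/ᵘ_)
import Data.Rational.Unnormalised.Properties as ℚᵘP
open import Data.Vec using (Vec; []; _∷_; sum; zipWith; tabulate)
open import Data.Vec.Properties using (tabulate-cong)
open import Data.Vec.Relation.Unary.All using (All; []; _∷_)
open import Function.Bundles using (_⇔_; mk⇔; Equivalence)
open import Relation.Binary.PropositionalEquality
open import Relation.Nullary using (contradiction)

open import Defs

open ≡-Reasoning

coprime-* : ∀ {a b n} → Coprime a n → Coprime b n → Coprime (a ℕ.* b) n
coprime-* a⊥n b⊥n (i∣ab , i∣n) = b⊥n (coprime-divisor i⊥a i∣ab , i∣n)
  where
  i⊥a : Coprime _ _
  i⊥a (j∣i , j∣a) = a⊥n (j∣a , ∣-trans j∣i i∣n)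

coprime-^ : ∀ {a n} → Coprime a n → ∀ k → Coprime (a ^ k) n
coprime-^ {n = n} a⊥n zero    = Coprimality.1-coprimeTo n
coprime-^         a⊥n (suc k) = coprime-* a⊥n (coprime-^ a⊥n k)

pos-1+m*n≡o*p : ∀ m n o p → 1 ℕ.+ m ℕ.* n ≡ o ℕ.* p → 1ℤ + + m * + n ≡ + o * + p
pos-1+m*n≡o*p m n o p eq = begin
  1ℤ + + m * + n    ≡⟨ cong (λ z → 1ℤ + z) (ℤP.pos-* m n) ⟨
  + (1 ℕ.+ m ℕ.* n) ≡⟨ cong +_ eq ⟩
  + (o ℕ.* p)       ≡⟨ ℤP.pos-* o p ⟩
  + o * + p         ∎

coprime⇒ℤ-Bézout : ∀ {a n} → Coprime a n → ∃₂ λ s t → s * + a + t * + n ≡ 1ℤ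
coprime⇒ℤ-Bézout {a} {n} a⊥n = fromℕ-Bézout (coprime-Bézout a⊥n)
  where
  fromℕ-Bézout : Bézout.Identity 1 a n → ∃₂ λ s t → s * + a + t * + n ≡ 1ℤ
  fromℕ-Bézout (Bézout.+- s t eq) =
    + s , - + t , +-case (+ s) (+ a) (+ t) (+ n) (sym (pos-1+m*n≡o*p t n s a eq))
    where
    +-case : ∀ S A T N → S * A ≡ 1ℤ + T * N → S * A + - T * N ≡ 1ℤ
    +-case S A T N SA≡ = begin
      S * A + - T * N          ≡⟨ cong (_+ - T * N) SA≡ ⟩
      1ℤ + T * N + - T * N     ≡⟨ solve (T List.∷ N List.∷ List.[]) ⟩
      1ℤ                       ∎
  fromℕ-Bézout (Bézout.-+ s t eq) =
    - + s , + t , -+case (+ s) (+ a) (+ t) (+ n) (sym (pos-1+m*n≡o*p s a t n eq))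
    where
    -+case : ∀ S A T N → T * N ≡ 1ℤ + S * A → - S * A + T * N ≡ 1ℤ
    -+case S A T N TN≡ = begin
      - S * A + T * N          ≡⟨ cong (λ z → - S * A + z) TN≡ ⟩
      - S * A + (1ℤ + S * A)   ≡⟨ solve (S List.∷ A List.∷ List.[]) ⟩
      1ℤ                       ∎

∣∧<⇒≡0 : ∀ {m n} → n ∣ m → m < n → m ≡ 0
∣∧<⇒≡0 {zero}  _   _   = refl
∣∧<⇒≡0 {suc m} n∣m m<n = contradiction (∣⇒≤ n∣m) (ℕP.<⇒≱ m<n)

module _ {y a : ℕ} .{{_ : NonZero y}} (a⊥y : Coprime a y) where

  split-residue : ∀ w → ∃₂ λ c A → c < y × w ≡ + c * + a + + y * A
  split-residue w =
    let s , t , bézout = coprime⇒ℤ-Bézout a⊥y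
        r = (w * s) %ℕ y
        q = (w * s) /ℕ y
    in  r , q * + a + w * t , n%ℕd<d (w * s) y ,
        reduce w s t (+ a) (+ y) (+ r) q bézout (a≡a%ℕn+[a/ℕn]*n (w * s) y)
    where
    reduce : ∀ w s t a y r q → s * a + t * y ≡ 1ℤ → w * s ≡ r + q * y →
             w ≡ r * a + y * (q * a + w * t)
    reduce w s t a y r q bézout ws≡ = begin
      w                           ≡⟨ ℤP.*-identityʳ w ⟨
      w * 1ℤ                      ≡⟨ cong (w *_) bézout ⟨
      w * (s * a + t * y)         ≡⟨ solve (w List.∷ s List.∷ t List.∷ a List.∷ y List.∷ List.[]) ⟩
      w * s * a + y * (w * t)     ≡⟨ cong (λ z → z * a + y * (w * t)) ws≡ ⟩
      (r + q * y) * a + y * (w * t) ≡⟨ solve (w List.∷ t List.∷ a List.∷ y List.∷ r List.∷ q List.∷ List.[]) ⟩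
      r * a + y * (q * a + w * t) ∎

  split-residue-unique : ∀ {c c′ A A′} → c < y → c′ < y →
    + c * + a + + y * A ≡ + c′ * + a + + y * A′ → c ≡ c′ × A ≡ A′
  split-residue-unique {c} {c′} {A} {A′} c<y c′<y eq = c≡c′ , A≡A′
    where
    difference : ∀ a y c c′ A A′ → c * a + y * A ≡ c′ * a + y * A′ → a * (c - c′) ≡ (A′ - A) * y
    difference a y c c′ A A′ eq = begin
      a * (c - c′)                      ≡⟨ solve (a List.∷ y List.∷ c List.∷ c′ List.∷ A List.∷ List.[]) ⟩
      (c * a + y * A) - (c′ * a + y * A)   ≡⟨ cong (_- (c′ * a + y * A)) eq ⟩
      (c′ * a + y * A′) - (c′ * a + y * A) ≡⟨ solve (a List.∷ y List.∷ c′ List.∷ A List.∷ A′ List.∷ List.[]) ⟩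
      (A′ - A) * y                      ∎
    y∣c-c′ : y ∣ ∣ + c - + c′ ∣
    y∣c-c′ = ℤC.coprime-divisor (+ y) (+ a) (+ c - + c′) (Coprimality.sym a⊥y)
               (∣⇒∣ᵤ (ℤS.divides (A′ - A) (difference (+ a) (+ y) (+ c) (+ c′) A A′ eq)))
    ∣c-c′∣<y : ∣ + c - + c′ ∣ < y
    ∣c-c′∣<y = subst (_< y) (cong ∣_∣ (sym (ℤP.[+m]-[+n]≡m⊖n c c′)))
                 (ℕP.≤-<-trans (ℤP.∣m⊝n∣≤m⊔n c c′) (ℕP.⊔-lub c<y c′<y))
    c≡c′ : c ≡ c′
    c≡c′ = ℤP.+-injective (ℤP.i-j≡0⇒i≡j (+ c) (+ c′) (ℤP.∣i∣≡0⇒i≡0 (∣∧<⇒≡0 y∣c-c′ ∣c-c′∣<y)))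
    A≡A′ : A ≡ A′
    A≡A′ = ℤP.*-cancelˡ-≡ (+ y) A A′ (+-cancelˡ (+ c * + a) (+ y * A) (+ y * A′)
             (subst (λ z → + c * + a + + y * A ≡ + z * + a + + y * A′) (sym c≡c′) eq))

sum-zipWith-*-scaled : ∀ a {k} (cs : Vec ℕ k) (g : Fin k → ℕ) →
  sum (zipWith ℕ._*_ cs (tabulate (λ i → a ℕ.* g i))) ≡ a ℕ.* sum (zipWith ℕ._*_ cs (tabulate g))
sum-zipWith-*-scaled a []       g = sym (ℕP.*-zeroʳ a)
sum-zipWith-*-scaled a (c ∷ cs) g = begin
  c ℕ.* (a ℕ.* g fzero) ℕ.+ sum (zipWith ℕ._*_ cs (tabulate (λ i → a ℕ.* g (fsuc i))))
    ≡⟨ cong₂ ℕ._+_ (x∙yz≈y∙xz c a (g fzero)) (sum-zipWith-*-scaled a cs (λ i → g (fsuc i))) ⟩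
  a ℕ.* (c ℕ.* g fzero) ℕ.+ a ℕ.* sum (zipWith ℕ._*_ cs (tabulate (λ i → g (fsuc i))))
    ≡⟨ ℕP.*-distribˡ-+ a _ _ ⟨
  a ℕ.* sum (zipWith ℕ._*_ (c ∷ cs) (tabulate g)) ∎

module _ (x y : ℕ) where

  lowSum-∷ : ∀ m c cs → lowSum x y (suc m) (c ∷ cs) ≡ c ℕ.* x ^ suc m ℕ.+ y ℕ.* lowSum x y m cs
  lowSum-∷ m c cs = cong₂ ℕ._+_ (cong (c ℕ.*_) (ℕP.*-identityʳ (x ^ suc m)))
    (begin
      sum (zipWith ℕ._*_ cs (tabulate (λ k → x ^ (m ℕ.∸ toℕ k) ℕ.* (y ℕ.* y ^ toℕ k))))
        ≡⟨ cong (λ v → sum (zipWith ℕ._*_ cs v))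
                (tabulate-cong (λ k → x∙yz≈y∙xz (x ^ (m ℕ.∸ toℕ k)) y (y ^ toℕ k))) ⟩
      sum (zipWith ℕ._*_ cs (tabulate (λ k → y ℕ.* d x y m k)))
        ≡⟨ sum-zipWith-*-scaled y cs (d x y m) ⟩
      y ℕ.* lowSum x y m cs ∎)

  -- Horner form of  Σᵢ cᵢ x^(k-1-i) yⁱ + f yᵏ.
  digits : ∀ {k} → Vec ℕ k → ℤ → ℤ
  digits {zero}  []       f = f
  digits {suc k} (c ∷ cs) f = + c * + (x ^ k) + + y * digits cs f

  lowSum-digits : ∀ m cs f → + lowSum x y m cs + f * + (y ^ suc m) ≡ digits cs f
  lowSum-digits zero (c ∷ []) f = begin
    + (c ℕ.* 1 ℕ.+ 0) + f * + (y ℕ.* 1)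
      ≡⟨ cong₂ (λ u v → + u + f * + v) (trans (ℕP.+-identityʳ _) (ℕP.*-identityʳ c)) (ℕP.*-identityʳ y) ⟩
    + c + f * + y
      ≡⟨ cong₂ _+_ (ℤP.*-identityʳ (+ c)) (ℤP.*-comm (+ y) f) ⟨
    + c * + 1 + + y * f ∎
  lowSum-digits (suc m) (c ∷ cs) f = begin
    + lowSum x y (suc m) (c ∷ cs) + f * + (y ^ suc (suc m))
      ≡⟨ cong₂ (λ u v → u + f * v) pos-lowSum-∷ (ℤP.pos-* y (y ^ suc m)) ⟩
    + c * + (x ^ suc m) + + y * + lowSum x y m cs + f * (+ y * + (y ^ suc m))
      ≡⟨ regroup (+ c * + (x ^ suc m)) (+ y) (+ lowSum x y m cs) f (+ (y ^ suc m)) ⟩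
    + c * + (x ^ suc m) + + y * (+ lowSum x y m cs + f * + (y ^ suc m))
      ≡⟨ cong (λ z → + c * + (x ^ suc m) + + y * z) (lowSum-digits m cs f) ⟩
    digits (c ∷ cs) f ∎
    where
    pos-lowSum-∷ : + lowSum x y (suc m) (c ∷ cs) ≡ + c * + (x ^ suc m) + + y * + lowSum x y m cs
    pos-lowSum-∷ = begin
      + lowSum x y (suc m) (c ∷ cs)                     ≡⟨ cong +_ (lowSum-∷ m c cs) ⟩
      + (c ℕ.* x ^ suc m ℕ.+ y ℕ.* lowSum x y m cs)     ≡⟨ ℤP.pos-+ (c ℕ.* x ^ suc m) _ ⟩
      + (c ℕ.* x ^ suc m) + + (y ℕ.* lowSum x y m cs)   ≡⟨ cong₂ _+_ (ℤP.pos-* c _) (ℤP.pos-* y _) ⟩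
      + c * + (x ^ suc m) + + y * + lowSum x y m cs     ∎
    regroup : ∀ C Y L f P → C + Y * L + f * (Y * P) ≡ C + Y * (L + f * P)
    regroup C Y L f P = solve (C List.∷ Y List.∷ L List.∷ f List.∷ P List.∷ List.[])

module _ {x y : ℕ} .{{_ : NonZero y}} (x⊥y : Coprime x y) where

  digits-exist : ∀ k w → ∃₂ λ (cs : Vec ℕ k) f → All (_< y) cs × w ≡ digits x y cs f
  digits-exist zero    w = [] , w , [] , refl
  digits-exist (suc k) w =
    let c  , A , c<y  , w≡ = split-residue (coprime-^ x⊥y k) w
        cs , f , cs<y , A≡ = digits-exist k A
    in  c ∷ cs , f , c<y ∷ cs<y , trans w≡ (cong (λ z → + c * + (x ^ k) + + y * z) A≡)

  digits-unique : ∀ {k} {cs cs′ : Vec ℕ k} {f f′} → All (_< y) cs → All (_< y) cs′ →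
                  digits x y cs f ≡ digits x y cs′ f′ → cs ≡ cs′ × f ≡ f′
  digits-unique         []           []             eq = refl , eq
  digits-unique {suc k} (c<y ∷ cs<y) (c′<y ∷ cs′<y) eq =
    let c≡c′   , rest≡ = split-residue-unique (coprime-^ x⊥y k) c<y c′<y eq
        cs≡cs′ , f≡f′  = digits-unique cs<y cs′<y rest≡
    in  cong₂ _∷_ c≡c′ cs≡cs′ , f≡f′

toℚᵘ-/ : ∀ i n → toℚᵘ (i / suc n) ≃ i /ᵘ suc n
toℚᵘ-/ i n = ℚP.toℚᵘ-fromℚᵘ (i /ᵘ suc n)

clear-denominator : ∀ p q e r x′ →
  (p / 1 ≡ q / 1 ℚ.+ (e / 1) ℚ.* (r / suc x′)) ⇔ (p * + suc x′ ≡ q * + suc x′ + e * r)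
clear-denominator p q e r x′ = mk⇔
  (λ eq → unfold (ℚᵘP.≃-trans (ℚᵘP.≃-sym (toℚᵘ-/ p 0)) (ℚᵘP.≃-trans (ℚP.toℚᵘ-cong eq) rhs≃)))
  (λ eq → ℚP.toℚᵘ-injective (ℚᵘP.≃-trans (toℚᵘ-/ p 0)
            (ℚᵘP.≃-trans (*≡* (trans eq (sym (ℤP.*-identityʳ _)))) (ℚᵘP.≃-sym rhs≃))))
  where
  N = q * + suc x′ + e * r

  -- ℚᵘ arithmetic leaves the denominators as x′ + 0 and x′ + 0 + 0, which are
  -- only propositionally equal to x′.
  sum≃ : q /ᵘ 1 ℚᵘ.+ (e /ᵘ 1 ℚᵘ.* (r /ᵘ suc x′)) ≃ N /ᵘ suc x′
  sum≃ = *≡* (cross (ℕP.+-identityʳ x′) (trans (ℕP.+-identityʳ _) (ℕP.+-identityʳ x′)))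
    where
    cross : ∀ {t u} → t ≡ x′ → u ≡ x′ → (q * + suc t + e * r * + 1) * + suc x′ ≡ N * + suc u
    cross refl refl = cong (λ z → (q * + suc x′ + z) * + suc x′) (ℤP.*-identityʳ (e * r))

  rhs≃ : toℚᵘ (q / 1 ℚ.+ (e / 1) ℚ.* (r / suc x′)) ≃ N /ᵘ suc x′
  rhs≃ = ℚᵘP.≃-trans (ℚP.toℚᵘ-homo-+ (q / 1) _)
           (ℚᵘP.≃-trans (ℚᵘP.+-cong (toℚᵘ-/ q 0)
             (ℚᵘP.≃-trans (ℚP.toℚᵘ-homo-* (e / 1) _) (ℚᵘP.*-cong (toℚᵘ-/ e 0) (toℚᵘ-/ r x′))))
           sum≃)

  unfold : p /ᵘ 1 ≃ N /ᵘ suc x′ → p * + suc x′ ≡ N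
  unfold (*≡* eq) = trans eq (ℤP.*-identityʳ N)

module _ {x′ y n : ℕ} (v : ℕ) where

  decomposition⇔digits : ∀ c f {e} → e ≡ f * + suc x′ →
    (+ v / 1 ≡ + lowSum (suc x′) y n c / 1 ℚ.+ e / 1 ℚ.* dTop (suc x′) y n)
    ⇔ (+ v ≡ digits (suc x′) y c f)
  decomposition⇔digits c f refl = mk⇔
    (λ eq → trans (ℤP.*-cancelʳ-≡ (+ v) _ X (trans (Equivalence.to cleared eq) (sym expand)))
                  (lowSum-digits (suc x′) y n c f))
    (λ eq → Equivalence.from cleared (begin
       + v * X                                   ≡⟨ cong (_* X) (trans eq (sym (lowSum-digits (suc x′) y n c f))) ⟩
       (+ lowSum (suc x′) y n c + f * Yⁿ⁺¹) * X ≡⟨ expand ⟩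
       + lowSum (suc x′) y n c * X + f * X * Yⁿ⁺¹ ∎))
    where
    X = + suc x′
    Yⁿ⁺¹ = + (y ^ suc n)
    cleared = clear-denominator (+ v) (+ lowSum (suc x′) y n c) (f * X) Yⁿ⁺¹ x′
    expand : (+ lowSum (suc x′) y n c + f * Yⁿ⁺¹) * X ≡ + lowSum (suc x′) y n c * X + f * X * Yⁿ⁺¹
    expand = distribute (+ lowSum (suc x′) y n c) f X Yⁿ⁺¹
      where
      distribute : ∀ L f X P → (L + f * P) * X ≡ L * X + f * X * P
      distribute L f X P = solve (L List.∷ f List.∷ X List.∷ P List.∷ List.[])

  module _ .{{_ : NonZero y}} (x⊥y : Coprime (suc x′) y) where

    decomposition-exists : ∃₂ λ c e → IsDecomp (suc x′) y n v c e
    decomposition-exists =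
      let c , f , c<y , v≡ = digits-exist x⊥y (suc n) (+ v)
      in  c , f * + suc x′ , c<y , ∣⇒∣ᵤ (ℤS.divides f refl) ,
          Equivalence.from (decomposition⇔digits c f refl) v≡

    decomposition-unique : ∀ {c c′ e e′} → IsDecomp (suc x′) y n v c e → IsDecomp (suc x′) y n v c′ e′ →
                           c ≡ c′ × e ≡ e′
    decomposition-unique {c} {c′} {e} {e′} (c<y , x∣e , eq) (c′<y , x∣e′ , eq′) =
      let ℤS.divides f  e≡fx   = ∣ᵤ⇒∣ {+ suc x′} {e} x∣e
          ℤS.divides f′ e′≡f′x = ∣ᵤ⇒∣ {+ suc x′} {e′} x∣e′
          c≡c′ , f≡f′ = digits-unique x⊥y c<y c′<y
            (trans (sym (Equivalence.to (decomposition⇔digits c f e≡fx) eq))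
                   (Equivalence.to (decomposition⇔digits c′ f′ e′≡f′x) eq′))
      in  c≡c′ , trans e≡fx (trans (cong (_* + suc x′) f≡f′) (sym e′≡f′x))

theorem7 : (n x y : ℕ) → 1 ≤ n → Coprime x y → 1 ≤ x → x < y →
    (v : ℕ) →
    ∃[ c ] ∃[ e ] (IsDecomp x y n v c e ×
    ((c′ : Vec ℕ (suc n)) (e′ : ℤ) → IsDecomp x y n v c′ e′ → c′ ≡ c × e′ ≡ e))
theorem7 n (suc x′) (suc y′) _ x⊥y (s≤s z≤n) (s≤s _) v =
  let c , e , decomposition = decomposition-exists {n = n} v x⊥y
  in  c , e , decomposition ,
      λ c′ e′ decomposition′ → decomposition-unique v x⊥y decomposition′ decomposition
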